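{- There is a constant $C>0$ such that $\mathrm{ch}_{\mathrm{sep}}(G) \ge C\log d$ for every bipartite graph $G$ with minimum degree $d$.
   Context: All graphs are finite and simple; $\log$ denotes the natural logarithm. For a graph $G=(V,E)$ and a positive integer $k$, a $k$-list-assignment is a map $L$ assigning to each vertex $v\in V$ a set $L(v)$ of exactly $k$ positive integers (colours). A colouring $c$ of $V$ is an $L$-colouring if $c(v)\in L(v)$ for every $v$; it is proper if $c(u)\neq c(v)$ for every edge $uv$. A $k$-list-assignment $L$ has maximum separation if $|L(u)\cap L(v)|\le 1$ for every edge $uv$ of $G$. $G$ is separation $k$-choosable if for every $k$-list-assignment $L$ with maximum separation there is a proper $L$-colouring of $G$. The separation choosability $\mathrm{ch}_{\mathrm{sep}}(G)$ is the least $k$ such that $G$ is separation $k$-choosable. -}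

module Defs where

open import Data.Nat using (ℕ; _≤_; _^_)
open import Data.Nat.Properties using (_≟_)
open import Data.Bool using (Bool; true; false; T)
open import Data.Bool.Properties using (T?)
open import Data.Fin using (Fin)
open import Data.List using (List; length; filter; allFin)
open import Data.List.Relation.Unary.All using (All)
open import Data.List.Relation.Unary.Unique.Propositional using (Unique)
open import Data.List.Membership.DecPropositional _≟_ using (_∈_; _∈?_)
open import Data.Product using (Σ; ∃; _×_)
open import Relation.Binary.PropositionalEquality using (_≡_; _≢_)

record Graph (n : ℕ) : Set where
  field
    adj   : Fin n → Fin n → Bool
    sym   : ∀ u v → adj u v ≡ adj v u
    irrefl : ∀ v → adj v v ≡ false

open Graph public

Edge : ∀ {n} → Graph n → Fin n → Fin n → Set
Edge G u v = adj G u v ≡ true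

degree : ∀ {n} → Graph n → Fin n → ℕ
degree {n} G v = length (filter (λ w → T? (adj G v w)) (allFin n))

HasMinDegree : ∀ {n} → Graph n → ℕ → Set
HasMinDegree G d = (∀ v → d ≤ degree G v) × (∃ λ v → degree G v ≡ d)

Bipartite : ∀ {n} → Graph n → Set
Bipartite {n} G = Σ (Fin n → Bool) λ side → ∀ u v → Edge G u v → side u ≢ side v

IsListAssignment : ∀ {n} → ℕ → (Fin n → List ℕ) → Set
IsListAssignment k L =
  ∀ v → Unique (L v) × length (L v) ≡ k × All (λ c → 1 ≤ c) (L v)

-- |A ∩ B| for duplicate-free lists A, B
∣_∩_∣ : List ℕ → List ℕ → ℕ
∣ A ∩ B ∣ = length (filter (λ x → x ∈? B) A)

MaxSeparation : ∀ {n} → Graph n → (Fin n → List ℕ) → Set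
MaxSeparation G L = ∀ u v → Edge G u v → ∣ L u ∩ L v ∣ ≤ 1

IsProperLColouring : ∀ {n} → Graph n → (Fin n → List ℕ) → (Fin n → ℕ) → Set
IsProperLColouring G L c = (∀ v → c v ∈ L v) × (∀ u v → Edge G u v → c u ≢ c v)

SepChoosable : ∀ {n} → Graph n → ℕ → Set
SepChoosable {n} G k =
  (L : Fin n → List ℕ) → IsListAssignment k L → MaxSeparation G L →
  Σ (Fin n → ℕ) λ c → IsProperLColouring G L c

-- Counting version of the probabilistic argument. Orient the bipartition so that A is the larger
-- side, fix k ≥ 1 and use the colours (i , j) with i < k and j < 2k. Every vertex of B draws a
-- random label (i , S , r) with S ⊆ [2k]; it is active when |S| = k and r = 0, and then gets the
-- row {(i , j) : j ∈ S}. If all degrees are at least D, a vertex of A is covered (each pair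
-- (i , S) with |S| = k labels an active neighbour) with probability at least 1/2, while few
-- vertices of B are active, so some labelling has 2^k (k · #active + 1) < #covered. Next every
-- vertex of A draws a random transversal {(i , g i) : i < k}. Fix a colouring of the active
-- vertices (k^#active of them): for a covered vertex, every type i has at least k + 1 colours
-- used on its neighbours, so its whole list is blocked with probability at least 2^-k. Hence some
-- choice of transversals blocks a covered vertex for every such colouring, and no proper
-- colouring exists. A row and a transversal share at most one colour, so the lists have maximum
-- separation, and D ≤ 4096^k.
module Submission where

open import Defs hiding (sym)

import Algebra.Properties.CommutativeSemigroup as CommutativeSemigroupProperties
open import Data.Bool using (Bool; true; false; not; _∧_; _∨_; if_then_else_)
open import Data.Bool.ListAction using (all)
open import Data.Bool.Properties as Bool using (T?)
open import Data.Empty using (⊥-elim)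
open import Data.Fin as Fin using (Fin; zero; suc)
import Data.Fin.Properties as FinP
open import Data.List using (List; []; _∷_; _++_; map; length; allFin; tabulate; filterᵇ; cartesianProduct; cartesianProductWith)
open import Data.List.Properties using (length-map; length-tabulate; map-tabulate; filter-none)
open import Data.List.Relation.Unary.All as All using (All)
import Data.List.Relation.Unary.All.Properties as AllP
open import Data.List.Relation.Unary.AllPairs using (_∷_)
open import Data.List.Relation.Unary.Any using (here; there)
open import Data.List.Relation.Unary.Unique.Propositional using (Unique)
import Data.List.Relation.Unary.Unique.Propositional.Properties as Unique
open import Data.List.Membership.Propositional using (_∈_)
open import Data.List.Membership.Propositional.Properties using (∈-allFin; ∈-cartesianProductWith⁺; ∈-cartesianProduct⁺; ∈-map⁻; ∈-filter⁻; ∈-tabulate⁻)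
open import Data.Nat using (ℕ; zero; suc; _+_; _*_; _∸_; _^_; _≤_; _<_; z≤n; s≤s; _≡ᵇ_; NonZero; >-nonZero)
open import Data.Nat.Properties
open import Data.Nat.Tactic.RingSolver using (solve-∀)
open import Data.List.Membership.DecPropositional _≟_ using (_∈?_)
open import Data.Product using (Σ; ∃; _×_; _,_; proj₁; proj₂)
open import Data.Vec as Vec using (Vec; lookup)
open import Data.Vec.Properties using (lookup∘tabulate)
import Data.Vec.Properties as VecP
open import Function using (_∘_)
open import Function.Bundles using (Equivalence)
open import Relation.Binary.Definitions using (DecidableEquality)
open import Relation.Binary.PropositionalEquality using (_≡_; _≢_; refl; sym; trans; cong; cong₂; subst; module ≡-Reasoning)
open import Relation.Nullary using (¬_; Dec; yes; no; does; contradiction)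
open import Relation.Nullary.Decidable using (dec-true)

module +-CS = CommutativeSemigroupProperties +-commutativeSemigroup
module *-CS = CommutativeSemigroupProperties *-commutativeSemigroup

module Counting where

  private variable A B C : Set

  ⟦_⟧ : Bool → ℕ
  ⟦ true ⟧ = 1
  ⟦ false ⟧ = 0

  ⟦⟧+⟦not⟧ : ∀ b → ⟦ b ⟧ + ⟦ not b ⟧ ≡ 1
  ⟦⟧+⟦not⟧ true = refl
  ⟦⟧+⟦not⟧ false = refl

  ⟦∧⟧≤⟦⟧ʳ : ∀ a b → ⟦ a ∧ b ⟧ ≤ ⟦ b ⟧
  ⟦∧⟧≤⟦⟧ʳ true b = ≤-refl
  ⟦∧⟧≤⟦⟧ʳ false b = z≤n

  ∧-elim : ∀ {a b} → a ∧ b ≡ true → a ≡ true × b ≡ true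
  ∧-elim {true} {true} _ = refl , refl

  ∧-intro : ∀ {a b} → a ≡ true → b ≡ true → a ∧ b ≡ true
  ∧-intro refl refl = refl

  ∑ : List A → (A → ℕ) → ℕ
  ∑ [] f = 0
  ∑ (x ∷ xs) f = f x + ∑ xs f

  ∑-++ : ∀ (xs ys : List A) f → ∑ (xs ++ ys) f ≡ ∑ xs f + ∑ ys f
  ∑-++ [] ys f = refl
  ∑-++ (x ∷ xs) ys f = trans (cong (f x +_) (∑-++ xs ys f)) (sym (+-assoc (f x) _ _))

  ∑-cong : ∀ (xs : List A) {f g} → (∀ x → f x ≡ g x) → ∑ xs f ≡ ∑ xs g
  ∑-cong [] f≡g = refl
  ∑-cong (x ∷ xs) f≡g = cong₂ _+_ (f≡g x) (∑-cong xs f≡g)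

  ∑-mono-≤ : ∀ (xs : List A) {f g} → (∀ x → f x ≤ g x) → ∑ xs f ≤ ∑ xs g
  ∑-mono-≤ [] f≤g = z≤n
  ∑-mono-≤ (x ∷ xs) f≤g = +-mono-≤ (f≤g x) (∑-mono-≤ xs f≤g)

  ∑-distrib-+ : ∀ (xs : List A) f g → ∑ xs (λ x → f x + g x) ≡ ∑ xs f + ∑ xs g
  ∑-distrib-+ [] f g = refl
  ∑-distrib-+ (x ∷ xs) f g = trans (cong (f x + g x +_) (∑-distrib-+ xs f g)) (+-CS.interchange (f x) (g x) _ _)

  ∑-const : ∀ (xs : List A) c → ∑ xs (λ _ → c) ≡ length xs * c
  ∑-const [] c = refl
  ∑-const (x ∷ xs) c = cong (c +_) (∑-const xs c)

  ∑-one : ∀ (xs : List A) → ∑ xs (λ _ → 1) ≡ length xs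
  ∑-one xs = trans (∑-const xs 1) (*-identityʳ (length xs))

  ∑-zero : ∀ (xs : List A) → ∑ xs (λ _ → 0) ≡ 0
  ∑-zero xs = trans (∑-const xs 0) (*-zeroʳ (length xs))

  ∑-*ˡ : ∀ (xs : List A) c f → ∑ xs (λ x → c * f x) ≡ c * ∑ xs f
  ∑-*ˡ [] c f = sym (*-zeroʳ c)
  ∑-*ˡ (x ∷ xs) c f = trans (cong (c * f x +_) (∑-*ˡ xs c f)) (sym (*-distribˡ-+ c (f x) _))

  ∑-*ʳ : ∀ (xs : List A) f c → ∑ xs (λ x → f x * c) ≡ ∑ xs f * c
  ∑-*ʳ [] f c = refl
  ∑-*ʳ (x ∷ xs) f c = trans (cong (f x * c +_) (∑-*ʳ xs f c)) (sym (*-distribʳ-+ c (f x) _))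

  ∑-complement : ∀ (xs : List A) p → ∑ xs (λ x → ⟦ p x ⟧) + ∑ xs (λ x → ⟦ not (p x) ⟧) ≡ length xs
  ∑-complement xs p = begin
    ∑ xs (λ x → ⟦ p x ⟧) + ∑ xs (λ x → ⟦ not (p x) ⟧) ≡⟨ ∑-distrib-+ xs _ _ ⟨
    ∑ xs (λ x → ⟦ p x ⟧ + ⟦ not (p x) ⟧)             ≡⟨ ∑-cong xs (⟦⟧+⟦not⟧ ∘ p) ⟩
    ∑ xs (λ _ → 1)                                   ≡⟨ ∑-const xs 1 ⟩
    length xs * 1                                    ≡⟨ *-identityʳ (length xs) ⟩
    length xs                                        ∎
    where open ≡-Reasoning

  ∈⇒≤∑ : ∀ {xs : List A} {x} f → x ∈ xs → f x ≤ ∑ xs f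
  ∈⇒≤∑ f (here refl) = m≤m+n _ _
  ∈⇒≤∑ {xs = y ∷ _} f (there x∈xs) = ≤-trans (∈⇒≤∑ f x∈xs) (m≤n+m _ (f y))

  ∑<∑⇒∃< : ∀ (xs : List A) f g → ∑ xs f < ∑ xs g → ∃ λ x → x ∈ xs × f x < g x
  ∑<∑⇒∃< (x ∷ xs) f g ∑f<∑g with f x <? g x
  ... | yes fx<gx = x , here refl , fx<gx
  ... | no fx≮gx =
    let y , y∈xs , fy<gy = ∑<∑⇒∃< xs f g (+-cancelˡ-< (f x) _ _ (<-≤-trans ∑f<∑g (+-monoˡ-≤ _ (≮⇒≥ fx≮gx))))
    in y , there y∈xs , fy<gy

  all-true : ∀ p (xs : List A) → all p xs ≡ true → ∀ {x} → x ∈ xs → p x ≡ true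
  all-true p (x ∷ xs) ≡true x∈ with p x in px
  all-true p (x ∷ xs) ≡true (here refl) | true = px
  all-true p (x ∷ xs) ≡true (there x∈) | true = all-true p xs ≡true x∈

  union-bound : ∀ p (xs : List A) → 1 ≤ ⟦ all p xs ⟧ + ∑ xs (λ x → ⟦ not (p x) ⟧)
  union-bound p [] = ≤-refl
  union-bound p (x ∷ xs) with p x
  ... | true = union-bound p xs
  ... | false = s≤s z≤n

  length-filterᵇ : ∀ (p : A → Bool) xs → length (filterᵇ p xs) ≡ ∑ xs (⟦_⟧ ∘ p)
  length-filterᵇ p [] = refl
  length-filterᵇ p (x ∷ xs) with p x
  ... | true = cong suc (length-filterᵇ p xs)
  ... | false = length-filterᵇ p xs

  ∑-map : ∀ (g : A → B) xs f → ∑ (map g xs) f ≡ ∑ xs (f ∘ g)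
  ∑-map g [] f = refl
  ∑-map g (x ∷ xs) f = cong (f (g x) +_) (∑-map g xs f)

  ∑-comm : ∀ (xs : List A) (ys : List B) (f : A → B → ℕ) → ∑ xs (λ x → ∑ ys (f x)) ≡ ∑ ys (λ y → ∑ xs (λ x → f x y))
  ∑-comm [] ys f = sym (∑-zero ys)
  ∑-comm (x ∷ xs) ys f =
    trans (cong (∑ ys (f x) +_) (∑-comm xs ys f)) (sym (∑-distrib-+ ys (f x) _))

  ∑-cartesianProductWith : ∀ (_⊕_ : A → B → C) xs ys (h : C → ℕ) →
    ∑ (cartesianProductWith _⊕_ xs ys) h ≡ ∑ xs (λ x → ∑ ys (λ y → h (x ⊕ y)))
  ∑-cartesianProductWith _⊕_ [] ys h = refl
  ∑-cartesianProductWith _⊕_ (x ∷ xs) ys h = begin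
    ∑ (map (x ⊕_) ys ++ cartesianProductWith _⊕_ xs ys) h
      ≡⟨ ∑-++ (map (x ⊕_) ys) _ h ⟩
    ∑ (map (x ⊕_) ys) h + ∑ (cartesianProductWith _⊕_ xs ys) h
      ≡⟨ cong₂ _+_ (∑-map (x ⊕_) ys h) (∑-cartesianProductWith _⊕_ xs ys h) ⟩
    ∑ ys (λ y → h (x ⊕ y)) + ∑ xs (λ x → ∑ ys (λ y → h (x ⊕ y))) ∎
    where open ≡-Reasoning

  length-cartesianProductWith : ∀ (_⊕_ : A → B → C) xs ys →
    length (cartesianProductWith _⊕_ xs ys) ≡ length xs * length ys
  length-cartesianProductWith _⊕_ xs ys = begin
    length (cartesianProductWith _⊕_ xs ys)      ≡⟨ ∑-one (cartesianProductWith _⊕_ xs ys) ⟨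
    ∑ (cartesianProductWith _⊕_ xs ys) (λ _ → 1) ≡⟨ ∑-cartesianProductWith _⊕_ xs ys (λ _ → 1) ⟩
    ∑ xs (λ _ → ∑ ys (λ _ → 1))                  ≡⟨ ∑-const xs (∑ ys (λ _ → 1)) ⟩
    length xs * ∑ ys (λ _ → 1)                   ≡⟨ cong (length xs *_) (∑-one ys) ⟩
    length xs * length ys                        ∎
    where open ≡-Reasoning

  ∑-allFin-suc : ∀ n f → ∑ (allFin (suc n)) f ≡ f zero + ∑ (allFin n) (f ∘ suc)
  ∑-allFin-suc n f = cong (f zero +_) (begin
    ∑ (tabulate suc) f           ≡⟨ cong (λ xs → ∑ xs f) (map-tabulate (λ i → i) suc) ⟨
    ∑ (map suc (allFin n)) f     ≡⟨ ∑-map suc (allFin n) f ⟩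
    ∑ (allFin n) (f ∘ suc)       ∎)
    where open ≡-Reasoning

  length-allFin : ∀ n → length (allFin n) ≡ n
  length-allFin n = length-tabulate (λ i → i)

  isZero : ∀ {n} → Fin n → Bool
  isZero zero = true
  isZero (suc _) = false

  ∑-isZero : ∀ n → ∑ (allFin (suc n)) (⟦_⟧ ∘ isZero) ≡ 1
  ∑-isZero n = trans (∑-allFin-suc n (⟦_⟧ ∘ isZero)) (cong suc (∑-zero (allFin n)))

  ∏ : ∀ {n} → (Fin n → ℕ) → ℕ
  ∏ {zero} f = 1
  ∏ {suc n} f = f zero * ∏ (f ∘ suc)

  ∏-cong : ∀ {n} {f g : Fin n → ℕ} → (∀ i → f i ≡ g i) → ∏ f ≡ ∏ g
  ∏-cong {zero} f≡g = refl
  ∏-cong {suc n} f≡g = cong₂ _*_ (f≡g zero) (∏-cong (f≡g ∘ suc))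

  ∏-mono-≤ : ∀ {n} {f g : Fin n → ℕ} → (∀ i → f i ≤ g i) → ∏ f ≤ ∏ g
  ∏-mono-≤ {zero} f≤g = ≤-refl
  ∏-mono-≤ {suc n} f≤g = *-mono-≤ (f≤g zero) (∏-mono-≤ (f≤g ∘ suc))

  ∏-const : ∀ n c → ∏ {n} (λ _ → c) ≡ c ^ n
  ∏-const zero c = refl
  ∏-const (suc n) c = cong (c *_) (∏-const n c)

  ∏-if : ∀ {n} (b : Fin n → Bool) p q →
    ∏ (λ i → if b i then p else q) * q ^ ∑ (allFin n) (⟦_⟧ ∘ b) ≡ p ^ ∑ (allFin n) (⟦_⟧ ∘ b) * q ^ n
  ∏-if {zero} b p q = refl
  ∏-if {suc n} b p q rewrite ∑-allFin-suc n (⟦_⟧ ∘ b) with b zero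
  ... | true = begin
    p * P * (q * q ^ s)     ≡⟨ *-CS.interchange p P q (q ^ s) ⟩
    p * q * (P * q ^ s)     ≡⟨ cong (p * q *_) (∏-if (b ∘ suc) p q) ⟩
    p * q * (p ^ s * q ^ n) ≡⟨ *-CS.interchange p q (p ^ s) (q ^ n) ⟩
    p * p ^ s * (q * q ^ n) ∎
    where
    open ≡-Reasoning
    P = ∏ (λ i → if b (suc i) then p else q)
    s = ∑ (allFin n) (⟦_⟧ ∘ b ∘ suc)
  ... | false = begin
    q * P * q ^ s           ≡⟨ *-assoc q P (q ^ s) ⟩
    q * (P * q ^ s)         ≡⟨ cong (q *_) (∏-if (b ∘ suc) p q) ⟩
    q * (p ^ s * q ^ n)     ≡⟨ *-CS.x∙yz≈y∙xz q (p ^ s) (q ^ n) ⟩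
    p ^ s * (q * q ^ n)     ∎
    where
    open ≡-Reasoning
    P = ∏ (λ i → if b (suc i) then p else q)
    s = ∑ (allFin n) (⟦_⟧ ∘ b ∘ suc)

  anyᶠ : ∀ {n} → (Fin n → Bool) → Bool
  anyᶠ {zero} p = false
  anyᶠ {suc n} p = p zero ∨ anyᶠ (p ∘ suc)

  allᶠ : ∀ {n} → (Fin n → Bool) → Bool
  allᶠ {zero} p = true
  allᶠ {suc n} p = p zero ∧ allᶠ (p ∘ suc)

  ⟦not-anyᶠ⟧ : ∀ {n} (p : Fin n → Bool) → ⟦ not (anyᶠ p) ⟧ ≡ ∏ (λ i → ⟦ not (p i) ⟧)
  ⟦not-anyᶠ⟧ {zero} p = refl
  ⟦not-anyᶠ⟧ {suc n} p with p zero
  ... | true = refl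
  ... | false = trans (⟦not-anyᶠ⟧ (p ∘ suc)) (sym (+-identityʳ _))

  ⟦allᶠ⟧ : ∀ {n} (p : Fin n → Bool) → ⟦ allᶠ p ⟧ ≡ ∏ (λ i → ⟦ p i ⟧)
  ⟦allᶠ⟧ {zero} p = refl
  ⟦allᶠ⟧ {suc n} p with p zero
  ... | true = trans (⟦allᶠ⟧ (p ∘ suc)) (sym (+-identityʳ _))
  ... | false = refl

  anyᶠ-witness : ∀ {n} (p : Fin n → Bool) → anyᶠ p ≡ true → ∃ λ i → p i ≡ true
  anyᶠ-witness {suc n} p any≡true with p zero in p0
  ... | true = zero , p0
  ... | false = let i , pi = anyᶠ-witness (p ∘ suc) any≡true in suc i , pi

  anyᶠ-intro : ∀ {n} (p : Fin n → Bool) i → p i ≡ true → anyᶠ p ≡ true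
  anyᶠ-intro p zero pi rewrite pi = refl
  anyᶠ-intro p (suc i) pi with p zero
  ... | true = refl
  ... | false = anyᶠ-intro (p ∘ suc) i pi

  allᶠ-elim : ∀ {n} (p : Fin n → Bool) → allᶠ p ≡ true → ∀ i → p i ≡ true
  allᶠ-elim {suc n} p all≡true i with p zero in p0
  allᶠ-elim {suc n} p all≡true zero | true = p0
  allᶠ-elim {suc n} p all≡true (suc i) | true = allᶠ-elim (p ∘ suc) all≡true i

  allᶠ-intro : ∀ {n} (p : Fin n → Bool) → (∀ i → p i ≡ true) → allᶠ p ≡ true
  allᶠ-intro {zero} p p≡true = refl
  allᶠ-intro {suc n} p p≡true rewrite p≡true zero = allᶠ-intro (p ∘ suc) (p≡true ∘ suc)

  does-true : ∀ {P : Set} (P? : Dec P) → does P? ≡ true → P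
  does-true (yes p) _ = p

  vectors : ∀ n → List A → List (Vec A n)
  vectors zero xs = Vec.[] ∷ []
  vectors (suc n) xs = cartesianProductWith Vec._∷_ xs (vectors n xs)

  ∈-vectors : ∀ {n} (xs : List A) (v : Vec A n) → (∀ i → lookup v i ∈ xs) → v ∈ vectors n xs
  ∈-vectors xs Vec.[] _ = here refl
  ∈-vectors xs (x Vec.∷ v) v⊆xs = ∈-cartesianProductWith⁺ Vec._∷_ (v⊆xs zero) (∈-vectors xs v (v⊆xs ∘ suc))

  length-vectors : ∀ n (xs : List A) → length (vectors n xs) ≡ length xs ^ n
  length-vectors zero xs = refl
  length-vectors (suc n) xs =
    trans (length-cartesianProductWith Vec._∷_ xs (vectors n xs)) (cong (length xs *_) (length-vectors n xs))

  ∑-vectors-∏ : ∀ n (xs : List A) (h : Fin n → A → ℕ) →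
    ∑ (vectors n xs) (λ v → ∏ (λ i → h i (lookup v i))) ≡ ∏ (λ i → ∑ xs (h i))
  ∑-vectors-∏ zero xs h = refl
  ∑-vectors-∏ (suc n) xs h = begin
    ∑ (vectors (suc n) xs) (λ v → ∏ (λ i → h i (lookup v i)))
      ≡⟨ ∑-cartesianProductWith Vec._∷_ xs (vectors n xs) _ ⟩
    ∑ xs (λ x → ∑ (vectors n xs) (λ v → h zero x * ∏ (λ i → h (suc i) (lookup v i))))
      ≡⟨ ∑-cong xs (λ x → ∑-*ˡ (vectors n xs) (h zero x) _) ⟩
    ∑ xs (λ x → h zero x * ∑ (vectors n xs) (λ v → ∏ (λ i → h (suc i) (lookup v i))))
      ≡⟨ ∑-cong xs (λ x → cong (h zero x *_) (∑-vectors-∏ n xs (h ∘ suc))) ⟩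
    ∑ xs (λ x → h zero x * ∏ (λ i → ∑ xs (h (suc i))))
      ≡⟨ ∑-*ʳ xs (h zero) _ ⟩
    ∑ xs (h zero) * ∏ (λ i → ∑ xs (h (suc i))) ∎
    where open ≡-Reasoning

  ∑-vectors-lookup : ∀ {n} (xs : List A) (g : A → ℕ) (x : Fin n) →
    ∑ (vectors n xs) (λ v → g (lookup v x)) * length xs ≡ ∑ xs g * length xs ^ n
  ∑-vectors-lookup {n = suc n} xs g zero = begin
    ∑ (vectors (suc n) xs) (λ v → g (lookup v zero)) * L ≡⟨ cong (_* L) (∑-cartesianProductWith Vec._∷_ xs (vectors n xs) _) ⟩
    ∑ xs (λ y → ∑ (vectors n xs) (λ _ → g y)) * L        ≡⟨ cong (_* L) (∑-cong xs (λ y → ∑-const (vectors n xs) (g y))) ⟩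
    ∑ xs (λ y → length (vectors n xs) * g y) * L         ≡⟨ cong (_* L) (∑-*ˡ xs (length (vectors n xs)) g) ⟩
    length (vectors n xs) * ∑ xs g * L                   ≡⟨ cong (λ m → m * ∑ xs g * L) (length-vectors n xs) ⟩
    L ^ n * ∑ xs g * L                                   ≡⟨ *-CS.xy∙z≈y∙zx (L ^ n) (∑ xs g) L ⟩
    ∑ xs g * (L * L ^ n)                                 ∎
    where
    open ≡-Reasoning
    L = length xs
  ∑-vectors-lookup {n = suc n} xs g (suc x) = begin
    ∑ (vectors (suc n) xs) (λ v → g (lookup v (suc x))) * L ≡⟨ cong (_* L) (∑-cartesianProductWith Vec._∷_ xs (vectors n xs) _) ⟩
    ∑ xs (λ _ → S) * L                                      ≡⟨ cong (_* L) (∑-const xs S) ⟩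
    L * S * L                                               ≡⟨ *-assoc L S L ⟩
    L * (S * L)                                             ≡⟨ cong (L *_) (∑-vectors-lookup xs g x) ⟩
    L * (∑ xs g * L ^ n)                                    ≡⟨ *-CS.x∙yz≈y∙xz L (∑ xs g) (L ^ n) ⟩
    ∑ xs g * (L * L ^ n)                                    ∎
    where
    open ≡-Reasoning
    L = length xs
    S = ∑ (vectors n xs) (λ w → g (lookup w x))

  size : ∀ {n} → Vec Bool n → ℕ
  size {n} S = ∑ (allFin n) (⟦_⟧ ∘ lookup S)

  size-∷ : ∀ {n} b (S : Vec Bool n) → size (b Vec.∷ S) ≡ ⟦ b ⟧ + size S
  size-∷ {n} b S = ∑-allFin-suc n (⟦_⟧ ∘ lookup (b Vec.∷ S))

  size-replicate-true : ∀ n → size (Vec.replicate n true) ≡ n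
  size-replicate-true n = begin
    size (Vec.replicate n true) ≡⟨ ∑-cong (allFin n) (λ j → cong ⟦_⟧ (VecP.lookup-replicate j true)) ⟩
    ∑ (allFin n) (λ _ → 1)      ≡⟨ ∑-one (allFin n) ⟩
    length (allFin n)           ≡⟨ length-allFin n ⟩
    n                           ∎
    where open ≡-Reasoning

  _⊆_ : ∀ {n} → Vec Bool n → Vec Bool n → Set
  S ⊆ P = ∀ j → lookup S j ≡ true → lookup P j ≡ true

  ∷-⊆ : ∀ {n a b} {S P : Vec Bool n} → (a ≡ true → b ≡ true) → S ⊆ P → (a Vec.∷ S) ⊆ (b Vec.∷ P)
  ∷-⊆ a⇒b S⊆P zero = a⇒b
  ∷-⊆ a⇒b S⊆P (suc j) = S⊆P j

  subset-of-size : ∀ {n} (P : Vec Bool n) t → t ≤ size P → ∃ λ S → size S ≡ t × S ⊆ P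
  subset-of-size Vec.[] zero _ = Vec.[] , refl , λ ()
  subset-of-size {suc n} (b Vec.∷ P) t t≤size with b | t | subst (t ≤_) (size-∷ b P) t≤size
  ... | true | suc t | s≤s t≤size′ = let S , size≡t , S⊆P = subset-of-size P t t≤size′
    in true Vec.∷ S , trans (size-∷ true S) (cong suc size≡t) , ∷-⊆ (λ _ → refl) S⊆P
  ... | b | zero | _ = let S , size≡0 , S⊆P = subset-of-size P zero z≤n
    in false Vec.∷ S , trans (size-∷ false S) size≡0 , ∷-⊆ (λ ()) S⊆P
  ... | false | suc t | t≤size′ = let S , size≡t , S⊆P = subset-of-size P (suc t) t≤size′
    in false Vec.∷ S , trans (size-∷ false S) size≡t , ∷-⊆ (λ ()) S⊆P

  subset-avoiding : ∀ {m} (p : Fin m → Bool) t → ∑ (allFin m) (⟦_⟧ ∘ p) + t ≤ m →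
    ∃ λ S → size S ≡ t × (∀ j → lookup S j ≡ true → p j ≡ false)
  subset-avoiding {m} p t fits =
    let S , size≡t , S⊆free = subset-of-size free t t≤size-free
    in S , size≡t , λ j j∈S → Bool.not-injective (trans (sym (lookup∘tabulate (not ∘ p) j)) (S⊆free j j∈S))
    where
    free = Vec.tabulate (not ∘ p)
    size-free : ∑ (allFin m) (⟦_⟧ ∘ p) + size free ≡ length (allFin m)
    size-free = trans (cong (∑ (allFin m) (⟦_⟧ ∘ p) +_) (∑-cong (allFin m) (λ j → cong ⟦_⟧ (lookup∘tabulate (not ∘ p) j))))
                      (∑-complement (allFin m) p)
    t≤size-free : t ≤ size free
    t≤size-free = +-cancelˡ-≤ _ t (size free) (≤-trans fits (≤-reflexive (sym (trans size-free (length-allFin m)))))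

  ∣∩∣≤1 : ∀ {xs ys} → Unique xs → (∀ {a b} → a ∈ xs → a ∈ ys → b ∈ xs → b ∈ ys → a ≡ b) → ∣ xs ∩ ys ∣ ≤ 1
  ∣∩∣≤1 {[]} _ _ = z≤n
  ∣∩∣≤1 {x ∷ xs} {ys} (x∉xs ∷ xs-unique) common with x ∈? ys
  ... | yes x∈ys = s≤s (≤-reflexive (cong length (filter-none (_∈? ys) (All.tabulate z∉ys))))
    where
    z∉ys : ∀ {z} → z ∈ xs → ¬ z ∈ ys
    z∉ys z∈xs z∈ys = All.lookup x∉xs z∈xs (common (here refl) x∈ys (there z∈xs) z∈ys)
  ... | no _ = ∣∩∣≤1 xs-unique (λ a∈ a∈ys b∈ b∈ys → common (there a∈) a∈ys (there b∈) b∈ys)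

module Growth where

  n≤2^n : ∀ n → n ≤ 2 ^ n
  n≤2^n zero = z≤n
  n≤2^n (suc n) = begin
    suc n         ≤⟨ s≤s (n≤2^n n) ⟩
    1 + 2 ^ n     ≤⟨ +-monoˡ-≤ (2 ^ n) (m^n>0 2 n) ⟩
    2 ^ n + 2 ^ n ≡⟨ cong (2 ^ n +_) (+-identityʳ (2 ^ n)) ⟨
    2 ^ suc n     ∎
    where open ≤-Reasoning

  ^-distribʳ-* : ∀ a b n → (a * b) ^ n ≡ a ^ n * b ^ n
  ^-distribʳ-* a b zero = refl
  ^-distribʳ-* a b (suc n) = trans (cong (a * b *_) (^-distribʳ-* a b n)) (*-CS.interchange a b (a ^ n) (b ^ n))

  double≤⇒< : ∀ a c → 0 < c → 2 * a ≤ c → a < c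
  double≤⇒< zero c c>0 _ = c>0
  double≤⇒< (suc a) c _ 2a≤c =
    <-≤-trans (m<m+n (suc a) (s≤s z≤n)) (≤-trans (≤-reflexive (cong (suc a +_) (sym (+-identityʳ (suc a))))) 2a≤c)

  bernoulli : ∀ a b m → a ^ suc m + suc m * b * a ^ m ≤ (a + b) ^ suc m
  bernoulli a b zero = ≤-reflexive (base a b)
    where
    base : ∀ a b → a * 1 + (b + 0) * 1 ≡ (a + b) * 1
    base = solve-∀
  bernoulli a b (suc m) = begin
    a * a ^ suc m + suc (suc m) * b * (a * a ^ m) ≡⟨ expand a b m (a ^ m) ⟩
    a * P + b * a ^ suc m                       ≤⟨ +-monoʳ-≤ (a * P) (m≤m+n (b * a ^ suc m) (b * (suc m * b * a ^ m))) ⟩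
    a * P + (b * a ^ suc m + b * (suc m * b * a ^ m)) ≡⟨ cong (a * P +_) (*-distribˡ-+ b (a ^ suc m) _) ⟨
    a * P + b * P                               ≡⟨ *-distribʳ-+ P a b ⟨
    (a + b) * P                                 ≤⟨ *-monoʳ-≤ (a + b) (bernoulli a b m) ⟩
    (a + b) * (a + b) ^ suc m                   ∎
    where
    open ≤-Reasoning
    P = a ^ suc m + suc m * b * a ^ m
    expand : ∀ a b m p → a * (a * p) + (2 + m) * b * (a * p) ≡ a * (a * p + (1 + m) * b * p) + b * (a * p)
    expand = solve-∀

  doubling : ∀ a b m → 1 ≤ m → a ≤ m * b → 2 * a ^ m ≤ (a + b) ^ m
  doubling a b (suc m) _ a≤mb = begin
    2 * a ^ suc m                 ≡⟨ cong (a ^ suc m +_) (+-identityʳ (a ^ suc m)) ⟩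
    a ^ suc m + a * a ^ m         ≤⟨ +-monoʳ-≤ (a ^ suc m) (*-monoˡ-≤ (a ^ m) a≤mb) ⟩
    a ^ suc m + suc m * b * a ^ m ≤⟨ bernoulli a b m ⟩
    (a + b) ^ suc m               ∎
    where open ≤-Reasoning

  amplification : ∀ {x y} m j e → x ≤ y → 2 * x ^ m ≤ y ^ m → j * m ≤ e → 2 ^ j * x ^ e ≤ y ^ e
  amplification {x} {y} m j e x≤y doubled jm≤e = begin
    2 ^ j * x ^ e                          ≡⟨ cong (λ e → 2 ^ j * x ^ e) (m+[n∸m]≡n jm≤e) ⟨
    2 ^ j * x ^ (j * m + (e ∸ j * m))      ≡⟨ cong (2 ^ j *_) (^-distribˡ-+-* x (j * m) _) ⟩
    2 ^ j * (x ^ (j * m) * x ^ (e ∸ j * m)) ≡⟨ *-assoc (2 ^ j) _ _ ⟨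
    2 ^ j * x ^ (j * m) * x ^ (e ∸ j * m)  ≤⟨ *-mono-≤ (blocks j) (^-monoˡ-≤ (e ∸ j * m) x≤y) ⟩
    y ^ (j * m) * y ^ (e ∸ j * m)          ≡⟨ ^-distribˡ-+-* y (j * m) _ ⟨
    y ^ (j * m + (e ∸ j * m))              ≡⟨ cong (y ^_) (m+[n∸m]≡n jm≤e) ⟩
    y ^ e                                  ∎
    where
    open ≤-Reasoning
    blocks : ∀ j → 2 ^ j * x ^ (j * m) ≤ y ^ (j * m)
    blocks zero = ≤-refl
    blocks (suc j) = begin
      2 * 2 ^ j * x ^ (m + j * m)          ≡⟨ cong (2 * 2 ^ j *_) (^-distribˡ-+-* x m (j * m)) ⟩
      2 * 2 ^ j * (x ^ m * x ^ (j * m))    ≡⟨ *-CS.interchange 2 (2 ^ j) (x ^ m) (x ^ (j * m)) ⟩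
      2 * x ^ m * (2 ^ j * x ^ (j * m))    ≤⟨ *-mono-≤ doubled (blocks j) ⟩
      y ^ m * y ^ (j * m)                  ≡⟨ ^-distribˡ-+-* y m (j * m) ⟨
      y ^ (m + j * m)                      ∎

module Palette (k M : ℕ) where

  open Counting

  colour : Fin k → Fin M → ℕ
  colour i j = suc (Fin.toℕ (Fin.combine i j))

  colour-injective : ∀ {i j i′ j′} → colour i j ≡ colour i′ j′ → i ≡ i′ × j ≡ j′
  colour-injective {i} {j} {i′} {j′} eq =
    FinP.combine-injective i j i′ j′ (FinP.toℕ-injective (suc-injective eq))

  row : Fin k → Vec Bool M → List ℕ
  row i S = map (colour i) (filterᵇ (lookup S) (allFin M))

  transversal : Vec (Fin M) k → List ℕ
  transversal g = tabulate (λ i → colour i (lookup g i))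

  length-row : ∀ i S → length (row i S) ≡ size S
  length-row i S = trans (length-map (colour i) (filterᵇ (lookup S) (allFin M))) (length-filterᵇ (lookup S) (allFin M))

  length-transversal : ∀ g → length (transversal g) ≡ k
  length-transversal g = length-tabulate _

  row-unique : ∀ i S → Unique (row i S)
  row-unique i S = Unique.map⁺ (proj₂ ∘ colour-injective) (Unique.filter⁺ (T? ∘ lookup S) (Unique.allFin⁺ M))

  transversal-unique : ∀ g → Unique (transversal g)
  transversal-unique g = Unique.tabulate⁺ (proj₁ ∘ colour-injective)

  row-positive : ∀ i S → All (1 ≤_) (row i S)
  row-positive i S = AllP.map⁺ (All.universal (λ _ → s≤s z≤n) _)

  transversal-positive : ∀ g → All (1 ≤_) (transversal g)
  transversal-positive g = AllP.tabulate⁺ (λ _ → s≤s z≤n)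

  ∈-row⁻ : ∀ {i S c} → c ∈ row i S → ∃ λ j → lookup S j ≡ true × c ≡ colour i j
  ∈-row⁻ {i} {S} c∈ =
    let j , j∈ , c≡ = ∈-map⁻ (colour i) {xs = filterᵇ (lookup S) (allFin M)} c∈
    in j , Bool.T-≡ .Equivalence.to (proj₂ (∈-filter⁻ (T? ∘ lookup S) {xs = allFin M} j∈)) , c≡

  ∈-transversal⁻ : ∀ {g c} → c ∈ transversal g → ∃ λ i → c ≡ colour i (lookup g i)
  ∈-transversal⁻ {g} = ∈-tabulate⁻ {f = λ i → colour i (lookup g i)}

  ∈-row∩transversal : ∀ {i S g c} → c ∈ row i S → c ∈ transversal g → c ≡ colour i (lookup g i)
  ∈-row∩transversal {i} {S} {g} c∈row c∈tr with ∈-row⁻ {i} {S} c∈row | ∈-transversal⁻ {g} c∈tr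
  ... | j , _ , c≡ij | i′ , c≡i′ with refl ← proj₁ (colour-injective (trans (sym c≡i′) c≡ij)) = c≡i′

  ∣transversal∩row∣≤1 : ∀ g i S → ∣ transversal g ∩ row i S ∣ ≤ 1
  ∣transversal∩row∣≤1 g i S = ∣∩∣≤1 (transversal-unique g) λ a∈tr a∈row b∈tr b∈row →
    trans (∈-row∩transversal {i} {S} {g} a∈row a∈tr) (sym (∈-row∩transversal {i} {S} {g} b∈row b∈tr))

  ∣row∩transversal∣≤1 : ∀ i S g → ∣ row i S ∩ transversal g ∣ ≤ 1
  ∣row∩transversal∣≤1 i S g = ∣∩∣≤1 (row-unique i S) λ a∈row a∈tr b∈row b∈tr →
    trans (∈-row∩transversal {i} {S} {g} a∈row a∈tr) (sym (∈-row∩transversal {i} {S} {g} b∈row b∈tr))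

-- A label takes T values, and D is chosen so that (1 - 1/T)^D ≤ 2^-(1 + k + M).
module Parameters (k₀ : ℕ) where

  k M R T D : ℕ
  k = suc k₀
  M = k + k
  R = suc (8 * 2 ^ k * k)
  T = k * 2 ^ M * R
  D = (1 + k + M) * T

module Construction (k₀ : ℕ) {N : ℕ} (G : Graph N) (side : Fin N → Bool)
                    (bipartite : ∀ u v → Edge G u v → side u ≢ side v) where

  open Counting
  open Growth
  open Parameters k₀
  open Palette k M

  -- The component r only makes a label rare: at most a 1/R fraction of labels is active.
  Label : Set
  Label = Fin k × Vec Bool M × Fin R

  subsets : List (Vec Bool M)
  subsets = vectors M (true ∷ false ∷ [])

  demands : List (Fin k × Vec Bool M)
  demands = cartesianProduct (allFin k) subsets

  labels : List Label
  labels = cartesianProduct (allFin k) (cartesianProduct subsets (allFin R))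

  ∈-subsets : ∀ S → S ∈ subsets
  ∈-subsets S = ∈-vectors _ S (λ j → ∈-bools (lookup S j))
    where
    ∈-bools : ∀ b → b ∈ true ∷ false ∷ []
    ∈-bools true = here refl
    ∈-bools false = there (here refl)

  ∈-labels : ∀ ℓ → ℓ ∈ labels
  ∈-labels (i , S , r) = ∈-cartesianProduct⁺ (∈-allFin i) (∈-cartesianProduct⁺ (∈-subsets S) (∈-allFin r))

  length-subsets : length subsets ≡ 2 ^ M
  length-subsets = length-vectors M (true ∷ false ∷ [])

  length-demands : length demands ≡ k * 2 ^ M
  length-demands = trans (length-cartesianProductWith _,_ (allFin k) subsets)
    (cong₂ _*_ (length-allFin k) length-subsets)

  length-labels : length labels ≡ T
  length-labels = begin
    length labels                                         ≡⟨ length-cartesianProductWith _,_ (allFin k) (cartesianProduct subsets (allFin R)) ⟩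
    length (allFin k) * length (cartesianProduct subsets (allFin R)) ≡⟨ cong (length (allFin k) *_) (length-cartesianProductWith _,_ subsets (allFin R)) ⟩
    length (allFin k) * (length subsets * length (allFin R)) ≡⟨ cong₂ (λ a b → a * (b * length (allFin R))) (length-allFin k) length-subsets ⟩
    k * (2 ^ M * length (allFin R))                       ≡⟨ cong (λ r → k * (2 ^ M * r)) (length-allFin R) ⟩
    k * (2 ^ M * R)                                       ≡⟨ *-assoc k (2 ^ M) R ⟨
    T                                                     ∎
    where open ≡-Reasoning

  _≟ℓ_ : DecidableEquality Label
  _≟ℓ_ = ×-≡-dec FinP._≟_ (×-≡-dec (VecP.≡-dec Bool._≟_) FinP._≟_)
    where open import Data.Product.Properties using () renaming (≡-dec to ×-≡-dec)

  isK : Vec Bool M → Bool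
  isK S = size S ≡ᵇ k

  isK⇒size≡k : ∀ {S} → isK S ≡ true → size S ≡ k
  isK⇒size≡k {S} isK≡true = ≡ᵇ⇒≡ (size S) k (Bool.T-≡ .Equivalence.from isK≡true)

  size≡k⇒isK : ∀ {S} → size S ≡ k → isK S ≡ true
  size≡k⇒isK {S} size≡k = Bool.T-≡ .Equivalence.to (≡⇒≡ᵇ (size S) k size≡k)

  active : Label → Bool
  active (i , S , r) = isK S ∧ isZero r

  deg : Fin N → ℕ
  deg x = ∑ (allFin N) (⟦_⟧ ∘ adj G x)

  nA nB : ℕ
  nA = ∑ (allFin N) (⟦_⟧ ∘ side)
  nB = ∑ (allFin N) (λ x → ⟦ not (side x) ⟧)

  edge-crosses : ∀ {x y} → Edge G x y → side y ≡ not (side x)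
  edge-crosses {x} {y} xy = Bool.¬-not (λ eq → bipartite x y xy (sym eq))

  edge-from-A : ∀ {a y} → side a ≡ true → Edge G a y → side y ≡ false
  edge-from-A sa ay = trans (edge-crosses ay) (cong not sa)

  deg≤∑ : ∀ x (p : Fin N → Bool) → (∀ {y} → Edge G x y → p y ≡ true) → deg x ≤ ∑ (allFin N) (⟦_⟧ ∘ p)
  deg≤∑ x p edge⇒p = ∑-mono-≤ (allFin N) pointwise
    where
    pointwise : ∀ y → ⟦ adj G x y ⟧ ≤ ⟦ p y ⟧
    pointwise y with adj G x y in xy
    ... | true rewrite edge⇒p xy = ≤-refl
    ... | false = z≤n

  deg≤nA : nB ≤ nA → ∀ x → deg x ≤ nA
  deg≤nA nB≤nA x with side x in sx
  ... | true = ≤-trans (deg≤∑ x (not ∘ side) (λ xy → cong not (edge-from-A sx xy))) nB≤nA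
  ... | false = deg≤∑ x side (λ xy → trans (edge-crosses xy) (cong not sx))

  T>0 : 0 < T
  T>0 = *-mono-≤ (*-mono-≤ (s≤s (z≤n {k₀})) (m^n>0 2 M)) (s≤s (z≤n {8 * 2 ^ k * k}))

  instance
    T-nonZero : NonZero T
    T-nonZero = >-nonZero T>0

  labellings : List (Vec Label N)
  labellings = vectors N labels

  length-labellings : length labellings ≡ T ^ N
  length-labellings = trans (length-vectors N labels) (cong (_^ N) length-labels)

  hits : Vec Label N → Fin N → Label → Bool
  hits lab x ℓ = anyᶠ (λ y → adj G x y ∧ does (lookup lab y ≟ℓ ℓ))

  satisfies : Vec Label N → Fin N → Fin k × Vec Bool M → Bool
  satisfies lab x (i , S) = not (isK S) ∨ hits lab x (i , S , zero)

  covered : Vec Label N → Fin N → Bool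
  covered lab x = all (satisfies lab x) demands

  covered⇒neighbour : ∀ {lab x} i S → covered lab x ≡ true → isK S ≡ true →
    ∃ λ y → Edge G x y × lookup lab y ≡ (i , S , zero)
  covered⇒neighbour {lab} {x} i S cov isK-S =
    let y , hit-y = anyᶠ-witness (λ y → adj G x y ∧ does (lookup lab y ≟ℓ (i , S , zero))) hit
        xy , lab-y = ∧-elim {adj G x y} hit-y
    in y , xy , does-true (lookup lab y ≟ℓ (i , S , zero)) lab-y
    where
    hit : hits lab x (i , S , zero) ≡ true
    hit = subst (λ b → not b ∨ hits lab x (i , S , zero) ≡ true) isK-S
      (all-true (satisfies lab x) demands cov (∈-cartesianProduct⁺ (∈-allFin i) (∈-subsets S)))

  nCovered nActive : Vec Label N → ℕ
  nCovered lab = ∑ (allFin N) (λ x → ⟦ side x ∧ covered lab x ⟧)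
  nActive lab = ∑ (allFin N) (λ y → ⟦ not (side y) ∧ active (lookup lab y) ⟧)

  ∑-others : ∀ ℓ → ∑ labels (λ e → ⟦ not (does (e ≟ℓ ℓ)) ⟧) ≤ T ∸ 1
  ∑-others ℓ = begin
    others                  ≡⟨ m+n∸m≡n equal others ⟨
    (equal + others) ∸ equal ≤⟨ ∸-monoʳ-≤ (equal + others) 1≤equal ⟩
    (equal + others) ∸ 1    ≡⟨ cong (_∸ 1) (trans (∑-complement labels (λ e → does (e ≟ℓ ℓ))) length-labels) ⟩
    T ∸ 1                   ∎
    where
    open ≤-Reasoning
    equal = ∑ labels (λ e → ⟦ does (e ≟ℓ ℓ) ⟧)
    others = ∑ labels (λ e → ⟦ not (does (e ≟ℓ ℓ)) ⟧)
    1≤equal : 1 ≤ equal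
    1≤equal = ≤-trans (≤-reflexive (cong ⟦_⟧ (sym (dec-true (ℓ ≟ℓ ℓ) refl))))
      (∈⇒≤∑ (λ e → ⟦ does (e ≟ℓ ℓ) ⟧) (∈-labels ℓ))

  missing : Fin N → ℕ
  missing x = ∏ (λ y → if adj G x y then T ∸ 1 else T)

  ∑-misses : ∀ x ℓ → ∑ labellings (λ lab → ⟦ not (hits lab x ℓ) ⟧) ≤ missing x
  ∑-misses x ℓ = begin
    ∑ labellings (λ lab → ⟦ not (hits lab x ℓ) ⟧)
      ≡⟨ ∑-cong labellings (λ lab → ⟦not-anyᶠ⟧ (λ y → adj G x y ∧ does (lookup lab y ≟ℓ ℓ))) ⟩
    ∑ labellings (λ lab → ∏ (λ y → ⟦ not (adj G x y ∧ does (lookup lab y ≟ℓ ℓ)) ⟧))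
      ≡⟨ ∑-vectors-∏ N labels (λ y e → ⟦ not (adj G x y ∧ does (e ≟ℓ ℓ)) ⟧) ⟩
    ∏ (λ y → ∑ labels (λ e → ⟦ not (adj G x y ∧ does (e ≟ℓ ℓ)) ⟧))
      ≤⟨ ∏-mono-≤ per-vertex ⟩
    missing x ∎
    where
    open ≤-Reasoning
    per-vertex : ∀ y → ∑ labels (λ e → ⟦ not (adj G x y ∧ does (e ≟ℓ ℓ)) ⟧) ≤ (if adj G x y then T ∸ 1 else T)
    per-vertex y with adj G x y
    ... | true = ∑-others ℓ
    ... | false = ≤-reflexive (trans (∑-one labels) length-labels)

  missing-rare : ∀ x → D ≤ deg x → 2 * (k * 2 ^ M) * missing x ≤ T ^ N
  missing-rare x D≤deg = *-cancelʳ-≤ _ _ (T ^ deg x) {{m^n≢0 T (deg x)}} (begin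
    Q * missing x * T ^ deg x      ≡⟨ *-assoc Q (missing x) _ ⟩
    Q * (missing x * T ^ deg x)    ≡⟨ cong (Q *_) (∏-if (adj G x) (T ∸ 1) T) ⟩
    Q * ((T ∸ 1) ^ deg x * T ^ N)  ≡⟨ *-assoc Q _ _ ⟨
    Q * (T ∸ 1) ^ deg x * T ^ N    ≤⟨ *-monoˡ-≤ (T ^ N) (*-monoˡ-≤ ((T ∸ 1) ^ deg x) Q≤2^J) ⟩
    2 ^ (1 + k + M) * (T ∸ 1) ^ deg x * T ^ N
      ≤⟨ *-monoˡ-≤ (T ^ N) (amplification T (1 + k + M) (deg x) (m∸n≤m T 1) doubled D≤deg) ⟩
    T ^ deg x * T ^ N              ≡⟨ *-comm (T ^ deg x) (T ^ N) ⟩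
    T ^ N * T ^ deg x              ∎)
    where
    open ≤-Reasoning
    Q = 2 * (k * 2 ^ M)
    Q≤2^J : Q ≤ 2 ^ (1 + k + M)
    Q≤2^J = *-monoʳ-≤ 2 (≤-trans (*-monoˡ-≤ (2 ^ M) (n≤2^n k)) (≤-reflexive (sym (^-distribˡ-+-* 2 k M))))
    doubled : 2 * (T ∸ 1) ^ T ≤ T ^ T
    doubled = subst (λ t → 2 * (T ∸ 1) ^ T ≤ t ^ T) (m∸n+n≡m T>0)
      (doubling (T ∸ 1) 1 T T>0 (≤-trans (m∸n≤m T 1) (≤-reflexive (sym (*-identityʳ T)))))

  unsatisfied⇒missed : ∀ lab x i S → ⟦ not (satisfies lab x (i , S)) ⟧ ≤ ⟦ not (hits lab x (i , S , zero)) ⟧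
  unsatisfied⇒missed lab x i S with isK S | hits lab x (i , S , zero)
  ... | true | true = z≤n
  ... | true | false = ≤-refl
  ... | false | _ = z≤n

  covered-often : ∀ x → D ≤ deg x → T ^ N ≤ 2 * ∑ labellings (λ lab → ⟦ covered lab x ⟧)
  covered-often x D≤deg = +-cancelʳ-≤ (T ^ N) (T ^ N) (2 * C) (begin
    T ^ N + T ^ N                              ≤⟨ +-mono-≤ union union ⟩
    (C + Q * missing x) + (C + Q * missing x)  ≡⟨ regroup C Q (missing x) ⟩
    2 * C + 2 * Q * missing x                  ≤⟨ +-monoʳ-≤ (2 * C) (missing-rare x D≤deg) ⟩
    2 * C + T ^ N                              ∎)
    where
    open ≤-Reasoning
    C = ∑ labellings (λ lab → ⟦ covered lab x ⟧)
    Q = k * 2 ^ M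
    regroup : ∀ c q m → c + q * m + (c + q * m) ≡ 2 * c + 2 * q * m
    regroup = solve-∀
    per-demand : ∀ d → ∑ labellings (λ lab → ⟦ not (satisfies lab x d) ⟧) ≤ missing x
    per-demand (i , S) = ≤-trans (∑-mono-≤ labellings (λ lab → unsatisfied⇒missed lab x i S)) (∑-misses x (i , S , zero))
    union : T ^ N ≤ C + Q * missing x
    union = begin
      T ^ N
        ≡⟨ trans (∑-one labellings) length-labellings ⟨
      ∑ labellings (λ _ → 1)
        ≤⟨ ∑-mono-≤ labellings (λ lab → union-bound (satisfies lab x) demands) ⟩
      ∑ labellings (λ lab → ⟦ covered lab x ⟧ + ∑ demands (λ d → ⟦ not (satisfies lab x d) ⟧))
        ≡⟨ ∑-distrib-+ labellings _ _ ⟩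
      C + ∑ labellings (λ lab → ∑ demands (λ d → ⟦ not (satisfies lab x d) ⟧))
        ≡⟨ cong (C +_) (∑-comm labellings demands (λ lab d → ⟦ not (satisfies lab x d) ⟧)) ⟩
      C + ∑ demands (λ d → ∑ labellings (λ lab → ⟦ not (satisfies lab x d) ⟧))
        ≤⟨ +-monoʳ-≤ C (∑-mono-≤ demands per-demand) ⟩
      C + ∑ demands (λ _ → missing x)
        ≡⟨ cong (C +_) (trans (∑-const demands (missing x)) (cong (_* missing x) length-demands)) ⟩
      C + Q * missing x ∎

  ∑-active-labels : ∑ labels (⟦_⟧ ∘ active) ≤ k * 2 ^ M
  ∑-active-labels = begin
    ∑ labels (⟦_⟧ ∘ active)
      ≡⟨ ∑-cartesianProductWith _,_ (allFin k) (cartesianProduct subsets (allFin R)) (⟦_⟧ ∘ active) ⟩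
    ∑ (allFin k) (λ i → ∑ (cartesianProduct subsets (allFin R)) (λ (S , r) → ⟦ isK S ∧ isZero r ⟧))
      ≡⟨ ∑-cong (allFin k) (λ i → ∑-cartesianProductWith _,_ subsets (allFin R) (λ (S , r) → ⟦ isK S ∧ isZero r ⟧)) ⟩
    ∑ (allFin k) (λ i → ∑ subsets (λ S → ∑ (allFin R) (λ r → ⟦ isK S ∧ isZero r ⟧)))
      ≤⟨ ∑-mono-≤ (allFin k) (λ i → ∑-mono-≤ subsets (λ S → at-most-one-zero (isK S))) ⟩
    ∑ (allFin k) (λ i → ∑ subsets (λ S → 1))
      ≡⟨ ∑-const (allFin k) _ ⟩
    length (allFin k) * ∑ subsets (λ S → 1)
      ≡⟨ cong₂ _*_ (length-allFin k) (trans (∑-one subsets) length-subsets) ⟩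
    k * 2 ^ M ∎
    where
    open ≤-Reasoning
    at-most-one-zero : ∀ b → ∑ (allFin R) (λ r → ⟦ b ∧ isZero r ⟧) ≤ 1
    at-most-one-zero b = ≤-trans (∑-mono-≤ (allFin R) (λ r → ⟦∧⟧≤⟦⟧ʳ b (isZero r))) (≤-reflexive (∑-isZero (8 * 2 ^ k * k)))

  active-rare : ∀ y → R * ∑ labellings (λ lab → ⟦ active (lookup lab y) ⟧) ≤ T ^ N
  active-rare y = *-cancelʳ-≤ _ _ T (begin
    R * A * T              ≡⟨ *-assoc R A T ⟩
    R * (A * T)            ≡⟨ cong (R *_) marginal ⟩
    R * (a * T ^ N)        ≡⟨ *-CS.x∙yz≈yx∙z R a (T ^ N) ⟩
    a * R * T ^ N          ≤⟨ *-monoˡ-≤ (T ^ N) (*-monoˡ-≤ R ∑-active-labels) ⟩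
    T * T ^ N              ≡⟨ *-comm T (T ^ N) ⟩
    T ^ N * T              ∎)
    where
    open ≤-Reasoning
    A = ∑ labellings (λ lab → ⟦ active (lookup lab y) ⟧)
    a = ∑ labels (⟦_⟧ ∘ active)
    marginal : A * T ≡ a * T ^ N
    marginal = subst (λ t → A * t ≡ a * t ^ N) length-labels (∑-vectors-lookup labels (⟦_⟧ ∘ active) y)

  ∑-nActive : R * ∑ labellings nActive ≤ nB * T ^ N
  ∑-nActive = begin
    R * ∑ labellings nActive
      ≡⟨ cong (R *_) (∑-comm labellings (allFin N) _) ⟩
    R * ∑ (allFin N) (λ y → ∑ labellings (λ lab → ⟦ not (side y) ∧ active (lookup lab y) ⟧))
      ≡⟨ ∑-*ˡ (allFin N) R _ ⟨
    ∑ (allFin N) (λ y → R * ∑ labellings (λ lab → ⟦ not (side y) ∧ active (lookup lab y) ⟧))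
      ≤⟨ ∑-mono-≤ (allFin N) per-vertex ⟩
    ∑ (allFin N) (λ y → ⟦ not (side y) ⟧ * T ^ N)
      ≡⟨ ∑-*ʳ (allFin N) _ (T ^ N) ⟩
    nB * T ^ N ∎
    where
    open ≤-Reasoning
    per-vertex : ∀ y → R * ∑ labellings (λ lab → ⟦ not (side y) ∧ active (lookup lab y) ⟧) ≤ ⟦ not (side y) ⟧ * T ^ N
    per-vertex y with side y
    ... | true = ≤-reflexive (trans (cong (R *_) (∑-zero labellings)) (*-zeroʳ R))
    ... | false = ≤-trans (active-rare y) (≤-reflexive (sym (*-identityˡ (T ^ N))))

  ∑-nCovered : (∀ x → D ≤ deg x) → nA * T ^ N ≤ 2 * ∑ labellings nCovered
  ∑-nCovered D≤deg = begin
    nA * T ^ N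
      ≡⟨ ∑-*ʳ (allFin N) _ (T ^ N) ⟨
    ∑ (allFin N) (λ x → ⟦ side x ⟧ * T ^ N)
      ≤⟨ ∑-mono-≤ (allFin N) per-vertex ⟩
    ∑ (allFin N) (λ x → 2 * ∑ labellings (λ lab → ⟦ side x ∧ covered lab x ⟧))
      ≡⟨ ∑-*ˡ (allFin N) 2 _ ⟩
    2 * ∑ (allFin N) (λ x → ∑ labellings (λ lab → ⟦ side x ∧ covered lab x ⟧))
      ≡⟨ cong (2 *_) (∑-comm labellings (allFin N) _) ⟨
    2 * ∑ labellings nCovered ∎
    where
    open ≤-Reasoning
    per-vertex : ∀ x → ⟦ side x ⟧ * T ^ N ≤ 2 * ∑ labellings (λ lab → ⟦ side x ∧ covered lab x ⟧)
    per-vertex x with side x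
    ... | true = ≤-trans (≤-reflexive (*-identityˡ (T ^ N))) (covered-often x (D≤deg x))
    ... | false = z≤n

  good-labelling : (∀ x → D ≤ deg x) → nB ≤ nA → 8 * 2 ^ k ≤ nA →
    ∃ λ lab → 2 ^ k * (k * nActive lab + 1) < nCovered lab
  good-labelling D≤deg nB≤nA 8·2^k≤nA =
    let lab , _ , lt = ∑<∑⇒∃< labellings (λ lab → 2 ^ k * (k * nActive lab + 1)) nCovered average
    in lab , lt
    where
    open ≤-Reasoning
    P = T ^ N
    SA = ∑ labellings nActive
    SC = ∑ labellings nCovered
    L = 2 ^ k * (k * SA + P)
    expected : ∑ labellings (λ lab → 2 ^ k * (k * nActive lab + 1)) ≡ L
    expected = begin-equality
      ∑ labellings (λ lab → 2 ^ k * (k * nActive lab + 1))       ≡⟨ ∑-*ˡ labellings (2 ^ k) _ ⟩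
      2 ^ k * ∑ labellings (λ lab → k * nActive lab + 1)         ≡⟨ cong (2 ^ k *_) (∑-distrib-+ labellings _ _) ⟩
      2 ^ k * (∑ labellings (λ lab → k * nActive lab) + ∑ labellings (λ _ → 1))
        ≡⟨ cong₂ (λ a b → 2 ^ k * (a + b)) (∑-*ˡ labellings k nActive) (trans (∑-one labellings) length-labellings) ⟩
      L ∎
    twice : 2 * L ≤ SC
    twice = *-cancelˡ-≤ 4 (begin
      4 * (2 * L)                   ≡⟨ expand (2 ^ k) k SA P ⟩
      8 * 2 ^ k * k * SA + 8 * 2 ^ k * P ≤⟨ +-mono-≤ (*-monoˡ-≤ SA (n≤1+n (8 * 2 ^ k * k))) (*-monoˡ-≤ P 8·2^k≤nA) ⟩
      R * SA + nA * P               ≤⟨ +-monoˡ-≤ (nA * P) ∑-nActive ⟩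
      nB * P + nA * P               ≤⟨ +-monoˡ-≤ (nA * P) (*-monoˡ-≤ P nB≤nA) ⟩
      nA * P + nA * P               ≤⟨ +-mono-≤ (∑-nCovered D≤deg) (∑-nCovered D≤deg) ⟩
      2 * SC + 2 * SC               ≡⟨ double-double SC ⟩
      4 * SC                        ∎)
      where
      expand : ∀ t k a p → 4 * (2 * (t * (k * a + p))) ≡ 8 * t * k * a + 8 * t * p
      expand = solve-∀
      double-double : ∀ s → 2 * s + 2 * s ≡ 4 * s
      double-double = solve-∀
    L>0 : 0 < L
    L>0 = *-mono-≤ (m^n>0 2 k) (≤-trans (m^n>0 T N) (m≤n+m P (k * SA)))
    average : ∑ labellings (λ lab → 2 ^ k * (k * nActive lab + 1)) < SC
    average = begin-strict
      ∑ labellings (λ lab → 2 ^ k * (k * nActive lab + 1)) ≡⟨ expected ⟩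
      L                  <⟨ m<m+n L L>0 ⟩
      L + L              ≡⟨ cong (L +_) (+-identityʳ L) ⟨
      2 * L              ≤⟨ twice ⟩
      SC                 ∎

  module Blocking (lab : Vec Label N) where

    type : Fin N → Fin k
    type y = proj₁ (lookup lab y)

    set : Fin N → Vec Bool M
    set y = proj₁ (proj₂ (lookup lab y))

    activeB coveredA : Fin N → Bool
    activeB y = not (side y) ∧ active (lookup lab y)
    coveredA a = side a ∧ covered lab a

    -- Inactive vertices are pinned to index zero, so a colouring determines a single choice vector.
    admissible : Fin N → Fin M → Bool
    admissible y j = if activeB y then lookup (set y) j else isZero j

    choices : List (Vec (Fin M) N)
    choices = vectors N (allFin M)

    transversals : List (Vec (Fin M) k)
    transversals = vectors k (allFin M)

    assignments : List (Vec (Vec (Fin M) k) N)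
    assignments = vectors N transversals

    consistent : Vec (Fin M) N → Bool
    consistent J = allᶠ (λ y → admissible y (lookup J y))

    taken : Vec (Fin M) N → Fin N → Fin k → Fin M → Bool
    taken J a i j = anyᶠ (λ y → adj G a y ∧ active (lookup lab y) ∧ does (type y FinP.≟ i) ∧ does (lookup J y FinP.≟ j))

    blocked : Vec (Fin M) N → Fin N → Vec (Fin M) k → Bool
    blocked J a g = allᶠ (λ i → taken J a i (lookup g i))

    someBlocked : Vec (Fin M) N → Vec (Vec (Fin M) k) N → Bool
    someBlocked J f = anyᶠ (λ a → coveredA a ∧ blocked J a (lookup f a))

    failures : Vec (Vec (Fin M) k) N → ℕ
    failures f = ∑ choices (λ J → ⟦ consistent J ∧ not (someBlocked J f) ⟧)

    consistent⇒∈set : ∀ {J y} → consistent J ≡ true → activeB y ≡ true → lookup (set y) (lookup J y) ≡ true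
    consistent⇒∈set {J} {y} cons act =
      subst (λ b → (if b then lookup (set y) (lookup J y) else isZero (lookup J y)) ≡ true) act
        (allᶠ-elim _ cons y)

    ∑-consistent : ∑ choices (⟦_⟧ ∘ consistent) ≡ k ^ nActive lab
    ∑-consistent = begin
      ∑ choices (⟦_⟧ ∘ consistent)
        ≡⟨ ∑-cong choices (λ J → ⟦allᶠ⟧ (λ y → admissible y (lookup J y))) ⟩
      ∑ choices (λ J → ∏ (λ y → ⟦ admissible y (lookup J y) ⟧))
        ≡⟨ ∑-vectors-∏ N (allFin M) (λ y j → ⟦ admissible y j ⟧) ⟩
      ∏ (λ y → ∑ (allFin M) (⟦_⟧ ∘ admissible y))
        ≡⟨ ∏-cong per-vertex ⟩
      ∏ (λ y → if activeB y then k else 1)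
        ≡⟨ *-identityʳ _ ⟨
      ∏ (λ y → if activeB y then k else 1) * 1
        ≡⟨ cong (∏ (λ y → if activeB y then k else 1) *_) (^-zeroˡ (nActive lab)) ⟨
      ∏ (λ y → if activeB y then k else 1) * 1 ^ nActive lab
        ≡⟨ ∏-if activeB k 1 ⟩
      k ^ nActive lab * 1 ^ N
        ≡⟨ cong (k ^ nActive lab *_) (^-zeroˡ N) ⟩
      k ^ nActive lab * 1
        ≡⟨ *-identityʳ _ ⟩
      k ^ nActive lab ∎
      where
      open ≡-Reasoning
      per-vertex : ∀ y → ∑ (allFin M) (⟦_⟧ ∘ admissible y) ≡ (if activeB y then k else 1)
      per-vertex y with activeB y in act
      ... | true = isK⇒size≡k {set y} (proj₁ (∧-elim (proj₂ (∧-elim {not (side y)} act))))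
      ... | false = ∑-isZero (k₀ + k)

    -- Otherwise k untaken indices form a demand (i , S) of a, and the neighbour meeting it uses one of them.
    many-taken : ∀ J a i → consistent J ≡ true → coveredA a ≡ true →
      suc k ≤ ∑ (allFin M) (⟦_⟧ ∘ taken J a i)
    many-taken J a i cons cov with suc k ≤? ∑ (allFin M) (⟦_⟧ ∘ taken J a i)
    ... | yes enough = enough
    ... | no few = ⊥-elim (true≢false (trans (sym taken-Jy) (S-untaken (lookup J y) J∈S)))
      where
      true≢false : true ≢ false
      true≢false ()
      chosen = subset-avoiding (taken J a i) k (+-monoˡ-≤ k (≮⇒≥ few))
      S = proj₁ chosen
      S-untaken : ∀ j → lookup S j ≡ true → taken J a i j ≡ false
      S-untaken = proj₂ (proj₂ chosen)
      isK-S : isK S ≡ true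
      isK-S = size≡k⇒isK {S} (proj₁ (proj₂ chosen))
      neighbour = covered⇒neighbour {lab} {a} i S (proj₂ (∧-elim {side a} cov)) isK-S
      y = proj₁ neighbour
      ay : Edge G a y
      ay = proj₁ (proj₂ neighbour)
      lab-y : lookup lab y ≡ (i , S , zero)
      lab-y = proj₂ (proj₂ neighbour)
      active-y : active (lookup lab y) ≡ true
      active-y = trans (cong active lab-y) (cong (_∧ true) isK-S)
      activeB-y : activeB y ≡ true
      activeB-y = trans (cong (λ s → not s ∧ active (lookup lab y)) (edge-from-A (proj₁ (∧-elim {side a} cov)) ay)) active-y
      J∈S : lookup S (lookup J y) ≡ true
      J∈S = subst (λ ℓ → lookup (proj₁ (proj₂ ℓ)) (lookup J y) ≡ true) lab-y (consistent⇒∈set {J} {y} cons activeB-y)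
      taken-Jy : taken J a i (lookup J y) ≡ true
      taken-Jy = anyᶠ-intro (λ z → adj G a z ∧ active (lookup lab z) ∧ does (type z FinP.≟ i) ∧ does (lookup J z FinP.≟ lookup J y)) y
        (∧-intro ay (∧-intro active-y (∧-intro (dec-true (type y FinP.≟ i) (cong proj₁ lab-y)) (dec-true (lookup J y FinP.≟ lookup J y) refl))))

    many-blocked : ∀ J a → consistent J ≡ true → coveredA a ≡ true →
      suc k ^ k ≤ ∑ transversals (λ g → ⟦ blocked J a g ⟧)
    many-blocked J a cons cov = begin
      suc k ^ k                                       ≡⟨ ∏-const k (suc k) ⟨
      ∏ {k} (λ _ → suc k)                             ≤⟨ ∏-mono-≤ (λ i → many-taken J a i cons cov) ⟩
      ∏ (λ i → ∑ (allFin M) (⟦_⟧ ∘ taken J a i))      ≡⟨ ∑-vectors-∏ k (allFin M) (λ i j → ⟦ taken J a i j ⟧) ⟨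
      ∑ transversals (λ g → ∏ (λ i → ⟦ taken J a i (lookup g i) ⟧))
        ≡⟨ ∑-cong transversals (λ g → ⟦allᶠ⟧ (λ i → taken J a i (lookup g i))) ⟨
      ∑ transversals (λ g → ⟦ blocked J a g ⟧)        ∎
      where open ≤-Reasoning

    u v w : ℕ
    u = M ^ k
    v = suc k ^ k
    w = u ∸ v

    length-transversals : length transversals ≡ u
    length-transversals = trans (length-vectors k (allFin M)) (cong (_^ k) (length-allFin M))

    ∑-unblocked : ∀ J a → consistent J ≡ true →
      ∑ transversals (λ g → ⟦ not (coveredA a ∧ blocked J a g) ⟧) ≤ (if coveredA a then w else u)
    ∑-unblocked J a cons with coveredA a in cov
    ... | true = begin
      unblocked                        ≡⟨ m+n∸m≡n blocked′ unblocked ⟨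
      (blocked′ + unblocked) ∸ blocked′ ≤⟨ ∸-monoʳ-≤ (blocked′ + unblocked) (many-blocked J a cons cov) ⟩
      (blocked′ + unblocked) ∸ v       ≡⟨ cong (_∸ v) (trans (∑-complement transversals (blocked J a)) length-transversals) ⟩
      w                                ∎
      where
      open ≤-Reasoning
      blocked′ = ∑ transversals (λ g → ⟦ blocked J a g ⟧)
      unblocked = ∑ transversals (λ g → ⟦ not (blocked J a g) ⟧)
    ... | false = ≤-reflexive (trans (∑-one transversals) length-transversals)

    Π : ℕ
    Π = ∏ (λ a → if coveredA a then w else u)

    ∑-escaping : ∀ J → ∑ assignments (λ f → ⟦ consistent J ∧ not (someBlocked J f) ⟧) ≤ ⟦ consistent J ⟧ * Π
    ∑-escaping J with consistent J in cons
    ... | false = ≤-reflexive (∑-zero assignments)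
    ... | true = begin
      ∑ assignments (λ f → ⟦ not (someBlocked J f) ⟧)
        ≡⟨ ∑-cong assignments (λ f → ⟦not-anyᶠ⟧ (λ a → coveredA a ∧ blocked J a (lookup f a))) ⟩
      ∑ assignments (λ f → ∏ (λ a → ⟦ not (coveredA a ∧ blocked J a (lookup f a)) ⟧))
        ≡⟨ ∑-vectors-∏ N transversals (λ a g → ⟦ not (coveredA a ∧ blocked J a g) ⟧) ⟩
      ∏ (λ a → ∑ transversals (λ g → ⟦ not (coveredA a ∧ blocked J a g) ⟧))
        ≤⟨ ∏-mono-≤ (λ a → ∑-unblocked J a cons) ⟩
      Π ≡⟨ *-identityˡ Π ⟨
      1 * Π ∎
      where open ≤-Reasoning

    ∑-failures : ∑ assignments failures ≤ k ^ nActive lab * Π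
    ∑-failures = begin
      ∑ assignments failures
        ≡⟨ ∑-comm assignments choices (λ f J → ⟦ consistent J ∧ not (someBlocked J f) ⟧) ⟩
      ∑ choices (λ J → ∑ assignments (λ f → ⟦ consistent J ∧ not (someBlocked J f) ⟧))
        ≤⟨ ∑-mono-≤ choices ∑-escaping ⟩
      ∑ choices (λ J → ⟦ consistent J ⟧ * Π) ≡⟨ ∑-*ʳ choices (⟦_⟧ ∘ consistent) Π ⟩
      ∑ choices (⟦_⟧ ∘ consistent) * Π       ≡⟨ cong (_* Π) ∑-consistent ⟩
      k ^ nActive lab * Π                    ∎
      where open ≤-Reasoning

    v≤u : v ≤ u
    v≤u = ^-monoˡ-≤ k (s≤s (m≤n+m k k₀))

    u>0 : 0 < u
    u>0 = ≤-trans (m^n>0 (suc k) k) v≤u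

    w≤2^k*v : w ≤ 2 ^ k * v
    w≤2^k*v = begin
      w               ≤⟨ m∸n≤m u v ⟩
      (k + k) ^ k     ≡⟨ cong (_^ k) (cong (k +_) (+-identityʳ k)) ⟨
      (2 * k) ^ k     ≡⟨ ^-distribʳ-* 2 k k ⟩
      2 ^ k * k ^ k   ≤⟨ *-monoʳ-≤ (2 ^ k) (^-monoˡ-≤ k (n≤1+n k)) ⟩
      2 ^ k * v       ∎
      where open ≤-Reasoning

    escape-bound : ∀ B X → 2 ^ k * (k * B + 1) < X → k ^ B * w ^ X < u ^ X
    escape-bound B X lt = double≤⇒< (k ^ B * w ^ X) (u ^ X) (m^n>0 u {{>-nonZero u>0}} X) (begin
      2 * (k ^ B * w ^ X)         ≤⟨ *-monoʳ-≤ 2 (*-monoˡ-≤ (w ^ X) (^-monoˡ-≤ B (n≤2^n k))) ⟩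
      2 * ((2 ^ k) ^ B * w ^ X)   ≡⟨ cong (λ p → 2 * (p * w ^ X)) (^-*-assoc 2 k B) ⟩
      2 * (2 ^ (k * B) * w ^ X)   ≡⟨ *-CS.x∙yz≈yx∙z 2 (2 ^ (k * B)) (w ^ X) ⟩
      2 ^ (k * B) * 2 * w ^ X     ≡⟨ cong (_* w ^ X) (^-distribˡ-+-* 2 (k * B) 1) ⟨
      2 ^ (k * B + 1) * w ^ X     ≤⟨ amplification (2 ^ k) (k * B + 1) X (m∸n≤m u v) halved kB+1≤X ⟩
      u ^ X                       ∎)
      where
      open ≤-Reasoning
      halved : 2 * w ^ (2 ^ k) ≤ u ^ (2 ^ k)
      halved = subst (λ t → 2 * w ^ (2 ^ k) ≤ t ^ (2 ^ k)) (m∸n+n≡m v≤u) (doubling w v (2 ^ k) (m^n>0 2 k) w≤2^k*v)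
      kB+1≤X : (k * B + 1) * 2 ^ k ≤ X
      kB+1≤X = ≤-trans (≤-reflexive (*-comm (k * B + 1) (2 ^ k))) (<⇒≤ lt)

    length-assignments : length assignments ≡ u ^ N
    length-assignments = trans (length-vectors N transversals) (cong (_^ N) length-transversals)

    good-assignment : 2 ^ k * (k * nActive lab + 1) < nCovered lab → ∃ λ f → failures f ≡ 0
    good-assignment lt = let f , _ , f<1 = ∑<∑⇒∃< assignments failures (λ _ → 1) total in f , n<1⇒n≡0 f<1
      where
      open ≤-Reasoning
      B = nActive lab
      X = nCovered lab
      fewer : k ^ B * Π < u ^ N
      fewer = *-cancelʳ-< (u ^ X) (k ^ B * Π) (u ^ N) (begin-strict
        k ^ B * Π * u ^ X          ≡⟨ *-assoc (k ^ B) Π (u ^ X) ⟩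
        k ^ B * (Π * u ^ X)        ≡⟨ cong (k ^ B *_) (∏-if coveredA w u) ⟩
        k ^ B * (w ^ X * u ^ N)    ≡⟨ *-assoc (k ^ B) (w ^ X) (u ^ N) ⟨
        k ^ B * w ^ X * u ^ N      <⟨ *-monoˡ-< (u ^ N) {{m^n≢0 u N {{>-nonZero u>0}}}} (escape-bound B X lt) ⟩
        u ^ X * u ^ N              ≡⟨ *-comm (u ^ X) (u ^ N) ⟩
        u ^ N * u ^ X              ∎)
      total : ∑ assignments failures < ∑ assignments (λ _ → 1)
      total = begin-strict
        ∑ assignments failures     ≤⟨ ∑-failures ⟩
        k ^ B * Π                  <⟨ fewer ⟩
        u ^ N                      ≡⟨ trans (∑-one assignments) length-assignments ⟨
        ∑ assignments (λ _ → 1)    ∎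

    failures≡0⇒someBlocked : ∀ {f J} → failures f ≡ 0 → consistent J ≡ true → someBlocked J f ≡ true
    failures≡0⇒someBlocked {f} {J} none cons = not≤0 (someBlocked J f)
      (subst (λ b → ⟦ b ∧ not (someBlocked J f) ⟧ ≤ 0) cons
        (≤-trans (∈⇒≤∑ (λ J → ⟦ consistent J ∧ not (someBlocked J f) ⟧) (∈-vectors (allFin M) J (λ y → ∈-allFin (lookup J y))))
                 (≤-reflexive none)))
      where
      not≤0 : ∀ b → ⟦ not b ⟧ ≤ 0 → b ≡ true
      not≤0 true _ = refl

  -- Inactive vertices of B only need some list of the right shape.
  fallback-subset : ∃ λ S → size S ≡ k × S ⊆ Vec.replicate M true
  fallback-subset = subset-of-size (Vec.replicate M true) k
    (subst (k ≤_) (sym (size-replicate-true M)) (m≤m+n k k))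

  fallback : Vec Bool M
  fallback = proj₁ fallback-subset

  size-fallback : size fallback ≡ k
  size-fallback = proj₁ (proj₂ fallback-subset)

  module ListAssignment (lab : Vec Label N) (f : Vec (Vec (Fin M) k) N) where

    open Blocking lab

    rowType : Fin N → Fin k
    rowType y = if active (lookup lab y) then type y else zero

    rowSet : Fin N → Vec Bool M
    rowSet y = if active (lookup lab y) then set y else fallback

    L : Fin N → List ℕ
    L y = if side y then transversal (lookup f y) else row (rowType y) (rowSet y)

    L-A : ∀ {y} → side y ≡ true → L y ≡ transversal (lookup f y)
    L-A {y} sy = cong (λ b → if b then transversal (lookup f y) else row (rowType y) (rowSet y)) sy

    L-B : ∀ {y} → side y ≡ false → L y ≡ row (rowType y) (rowSet y)
    L-B {y} sy = cong (λ b → if b then transversal (lookup f y) else row (rowType y) (rowSet y)) sy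

    size-rowSet : ∀ y → size (rowSet y) ≡ k
    size-rowSet y with active (lookup lab y) in act
    ... | true = isK⇒size≡k {set y} (proj₁ (∧-elim act))
    ... | false = size-fallback

    L-isListAssignment : IsListAssignment k L
    L-isListAssignment y with side y in sy
    ... | true = transversal-unique g , length-transversal g , transversal-positive g
      where g = lookup f y
    ... | false =
      row-unique (rowType y) (rowSet y) , trans (length-row (rowType y) (rowSet y)) (size-rowSet y) , row-positive (rowType y) (rowSet y)

    L-maxSeparation : MaxSeparation G L
    L-maxSeparation x y xy with side x in sx | side y in sy
    ... | true | false = ∣transversal∩row∣≤1 (lookup f x) (rowType y) (rowSet y)
    ... | false | true = ∣row∩transversal∣≤1 (rowType x) (rowSet x) (lookup f y)
    ... | true | true = ⊥-elim (bipartite x y xy (trans sx (sym sy)))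
    ... | false | false = ⊥-elim (bipartite x y xy (trans sx (sym sy)))

    choice-of : ∀ (c : Fin N → ℕ) → (∀ y → c y ∈ L y) →
      ∃ λ J → consistent J ≡ true × (∀ y → activeB y ≡ true → c y ≡ colour (type y) (lookup J y))
    choice-of c c∈L = J , J-consistent , J-colours
      where
      decode : ∀ y → activeB y ≡ true → ∃ λ j → lookup (set y) j ≡ true × c y ≡ colour (type y) j
      decode y act = ∈-row⁻ {type y} {set y}
        (subst (c y ∈_) (trans (L-B {y} sy) (cong (λ b → row (if b then type y else zero) (if b then set y else fallback)) active-y)) (c∈L y))
        where
        sy : side y ≡ false
        sy = Bool.not-injective (proj₁ (∧-elim act))
        active-y : active (lookup lab y) ≡ true
        active-y = proj₂ (∧-elim {not (side y)} act)
      pick : ∀ y → Σ (Fin M) λ j → (if activeB y then lookup (set y) j else isZero j) ≡ true ×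
                                    (activeB y ≡ true → c y ≡ colour (type y) j)
      pick y with activeB y in act
      ... | true = let j , j∈set , c≡ = decode y act in j , j∈set , λ _ → c≡
      ... | false = zero , refl , λ ()
      J : Vec (Fin M) N
      J = Vec.tabulate (proj₁ ∘ pick)
      J-consistent : consistent J ≡ true
      J-consistent = allᶠ-intro _ λ y →
        subst (λ j → admissible y j ≡ true) (sym (lookup∘tabulate (proj₁ ∘ pick) y)) (proj₁ (proj₂ (pick y)))
      J-colours : ∀ y → activeB y ≡ true → c y ≡ colour (type y) (lookup J y)
      J-colours y act = trans (proj₂ (proj₂ (pick y)) act) (cong (colour (type y)) (sym (lookup∘tabulate (proj₁ ∘ pick) y)))

    no-proper-colouring : failures f ≡ 0 → ∀ c → ¬ IsProperLColouring G L c
    no-proper-colouring none c (c∈L , proper) = proper a y ay (sym cy≡ca)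
      where
      choice = choice-of c c∈L
      J = proj₁ choice
      blocked-vertex = anyᶠ-witness (λ a → coveredA a ∧ blocked J a (lookup f a)) (failures≡0⇒someBlocked {f} {J} none (proj₁ (proj₂ choice)))
      a = proj₁ blocked-vertex
      g = lookup f a
      sa : side a ≡ true
      sa = proj₁ (∧-elim (proj₁ (∧-elim (proj₂ blocked-vertex))))
      a-blocked : blocked J a g ≡ true
      a-blocked = proj₂ (∧-elim {coveredA a} (proj₂ blocked-vertex))
      ca∈transversal = ∈-transversal⁻ {g} (subst (c a ∈_) (L-A {a} sa) (c∈L a))
      i = proj₁ ca∈transversal
      conflict = anyᶠ-witness (λ z → adj G a z ∧ active (lookup lab z) ∧ does (type z FinP.≟ i) ∧ does (lookup J z FinP.≟ lookup g i))
                              (allᶠ-elim (λ i → taken J a i (lookup g i)) a-blocked i)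
      y = proj₁ conflict
      facts = ∧₄-elim {adj G a y} (proj₂ conflict)
        where
        ∧₄-elim : ∀ {p q r s} → p ∧ q ∧ r ∧ s ≡ true → p ≡ true × q ≡ true × r ≡ true × s ≡ true
        ∧₄-elim {true} {true} {true} {true} _ = refl , refl , refl , refl
      ay : Edge G a y
      ay = proj₁ facts
      active-y : active (lookup lab y) ≡ true
      active-y = proj₁ (proj₂ facts)
      type≡i : type y ≡ i
      type≡i = does-true (type y FinP.≟ i) (proj₁ (proj₂ (proj₂ facts)))
      J≡g : lookup J y ≡ lookup g i
      J≡g = does-true (lookup J y FinP.≟ lookup g i) (proj₂ (proj₂ (proj₂ facts)))
      activeB-y : activeB y ≡ true
      activeB-y = trans (cong (λ s → not s ∧ active (lookup lab y)) (edge-from-A sa ay)) active-y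
      cy≡ca : c y ≡ c a
      cy≡ca = begin
        c y                                  ≡⟨ proj₂ (proj₂ choice) y activeB-y ⟩
        colour (type y) (lookup J y)         ≡⟨ cong₂ colour type≡i J≡g ⟩
        colour i (lookup g i)                ≡⟨ proj₂ ca∈transversal ⟨
        c a                                  ∎
        where open ≡-Reasoning

  degree≡deg : ∀ x → degree G x ≡ deg x
  degree≡deg x = length-filterᵇ (adj G x) (allFin N)

  8·2^k≤D : 8 * 2 ^ k ≤ D
  8·2^k≤D = begin
    8 * 2 ^ k          ≤⟨ m≤m*n (8 * 2 ^ k) k ⟩
    8 * 2 ^ k * k      ≤⟨ n≤1+n _ ⟩
    R                  ≤⟨ m≤n*m R (k * 2 ^ M) {{>-nonZero (*-mono-≤ (s≤s (z≤n {k₀})) (m^n>0 2 M))}} ⟩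
    T                  ≤⟨ m≤n*m T (1 + k + M) ⟩
    D                  ∎
    where open ≤-Reasoning

  not-choosable : (∀ x → D ≤ degree G x) → nB ≤ nA → Fin N → ¬ SepChoosable G k
  not-choosable D≤degree nB≤nA x choosable = no-proper-colouring none c proper
    where
    D≤deg : ∀ x → D ≤ deg x
    D≤deg x = subst (D ≤_) (degree≡deg x) (D≤degree x)
    labelling = good-labelling D≤deg nB≤nA (≤-trans 8·2^k≤D (≤-trans (D≤deg x) (deg≤nA nB≤nA x)))
    lab = proj₁ labelling
    assignment = Blocking.good-assignment lab (proj₂ labelling)
    f = proj₁ assignment
    none = proj₂ assignment
    open ListAssignment lab f
    colouring = choosable L L-isListAssignment L-maxSeparation
    c = proj₁ colouring
    proper = proj₂ colouring

D≤4096^k : ∀ k₀ → Parameters.D k₀ ≤ 4096 ^ suc k₀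
D≤4096^k k₀ = begin
  (1 + k + (k + k)) * (k * 2 ^ (k + k) * R)  ≤⟨ *-mono-≤ 1+3k≤4t (*-mono-≤ (*-mono-≤ (n≤2^n k) (≤-reflexive (^-distribˡ-+-* 2 k k))) R≤9t²) ⟩
  4 * t * (t * (t * t) * (9 * (t * t)))      ≡⟨ collect t ⟩
  36 * t ^ 6                                 ≤⟨ *-monoˡ-≤ (t ^ 6) (≤-trans (m≤m+n 36 28) (^-monoˡ-≤ 6 2≤t)) ⟩
  t ^ 6 * t ^ 6                              ≡⟨ ^-distribˡ-+-* t 6 6 ⟨
  (2 ^ k) ^ 12                               ≡⟨ ^-*-assoc 2 k 12 ⟩
  2 ^ (k * 12)                               ≡⟨ cong (2 ^_) (*-comm k 12) ⟩
  2 ^ (12 * k)                               ≡⟨ ^-*-assoc 2 12 k ⟨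
  4096 ^ k                                   ∎
  where
  open ≤-Reasoning
  open Parameters k₀
  open Growth
  t = 2 ^ k
  2≤t : 2 ≤ t
  2≤t = *-monoʳ-≤ 2 (m^n>0 2 k₀)
  1+3k≤4t : 1 + k + (k + k) ≤ 4 * t
  1+3k≤4t = ≤-trans (+-monoˡ-≤ (k + k) (+-monoˡ-≤ k (s≤s (z≤n {k₀})))) (≤-trans (≤-reflexive (four k)) (*-monoʳ-≤ 4 (n≤2^n k)))
    where
    four : ∀ k → k + k + (k + k) ≡ 4 * k
    four = solve-∀
  R≤9t² : R ≤ 9 * (t * t)
  R≤9t² = begin
    1 + 8 * t * k        ≤⟨ +-monoˡ-≤ (8 * t * k) (*-mono-≤ (m^n>0 2 k) (s≤s (z≤n {k₀}))) ⟩
    t * k + 8 * t * k    ≡⟨ nine t k ⟩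
    9 * (t * k)          ≤⟨ *-monoʳ-≤ 9 (*-monoʳ-≤ t (n≤2^n k)) ⟩
    9 * (t * t)          ∎
    where
    nine : ∀ t k → t * k + 8 * t * k ≡ 9 * (t * k)
    nine = solve-∀
  collect : ∀ t → 4 * t * (t * (t * t) * (9 * (t * t))) ≡ 36 * (t * (t * (t * (t * (t * (t * 1))))))
  collect = solve-∀

open Counting using (⟦_⟧; ∑; ∑-cong)

choosable⇒mindegree<D : ∀ {N} (G : Graph N) → Bipartite G → Fin N → ∀ k₀ {d} →
  (∀ v → d ≤ degree G v) → SepChoosable G (suc k₀) → d < Parameters.D k₀
choosable⇒mindegree<D {N} G (side , bipartite) x k₀ {d} d≤degree choosable with Parameters.D k₀ ≤? d
... | no D≰d = ≰⇒> D≰d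
... | yes D≤d = contradiction choosable (larger-side-as-A (λ v → ≤-trans D≤d (d≤degree v)))
  where
  flipped : ∀ u v → Edge G u v → not (side u) ≢ not (side v)
  flipped u v uv = bipartite u v uv ∘ Bool.not-injective
  larger-side-as-A : (∀ v → Parameters.D k₀ ≤ degree G v) → ¬ SepChoosable G (suc k₀)
  larger-side-as-A D≤degree with ∑ (allFin N) (λ x → ⟦ not (side x) ⟧) ≤? ∑ (allFin N) (⟦_⟧ ∘ side)
  ... | yes nB≤nA = Construction.not-choosable k₀ G side bipartite D≤degree nB≤nA x
  ... | no nB≰nA = Construction.not-choosable k₀ G (not ∘ side) flipped D≤degree nB′≤nA′ x
    where
    nB′≤nA′ : ∑ (allFin N) (λ x → ⟦ not (not (side x)) ⟧) ≤ ∑ (allFin N) (λ x → ⟦ not (side x) ⟧)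
    nB′≤nA′ = ≤-trans (≤-reflexive (∑-cong (allFin N) (λ x → cong ⟦_⟧ (Bool.not-involutive (side x))))) (<⇒≤ (≰⇒> nB≰nA))

theorem1p2 : ∃ λ (K : ℕ) → ∀ (n : ℕ) (G : Graph (suc n)) (d : ℕ) →
    Bipartite G → HasMinDegree G d →
    ∀ (k : ℕ) → 1 ≤ k → SepChoosable G k → d ≤ K ^ k
theorem1p2 = 4096 , λ where
  n G d _ _ zero ()
  n G d bipartite (d≤degree , _) (suc k₀) _ choosable →
    <⇒≤ (<-≤-trans (choosable⇒mindegree<D G bipartite zero k₀ d≤degree choosable) (D≤4096^k k₀))
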